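{- For every prime $p > 3$, $g(p) = 2p$.
   Context: For a non-negative integer $n$, $g(n)$ is the least integer $k$ such that there exists a strictly increasing sequence of integers $n = a_1 < a_2 < \cdots < a_t = k$ ($t \geq 1$) whose product $a_1 a_2 \cdots a_t$ is a perfect square. -}

module Defs where

open import Data.Nat using (ℕ; _*_; _<_; _≤_)
open import Data.List using (List; []; _∷_; last)
open import Data.Nat.ListAction using (product)
open import Data.List.Relation.Unary.Linked using (Linked)
open import Data.Maybe using (just)
open import Data.Product using (Σ; ∃; _×_)
open import Relation.Binary.PropositionalEquality using (_≡_)

IsSquare : ℕ → Set
IsSquare m = ∃ λ r → m ≡ r * r

GoodSeq : ℕ → ℕ → List ℕ → Set
GoodSeq n k as =
  Σ (List ℕ) λ rest → (as ≡ n ∷ rest)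
    × Linked _<_ as
    × (last as ≡ just k)
    × IsSquare (product as)

Reachable : ℕ → ℕ → Set
Reachable n k = ∃ λ as → GoodSeq n k as

IsG : ℕ → ℕ → Set
IsG n k = Reachable n k × (∀ k′ → Reachable n k′ → k ≤ k′)

-- A square product n · a₂ ⋯ aₜ with n = p prime forces p to divide some later term; that
-- term is a multiple of p exceeding p, hence at least 2p, so g(p) ≥ 2p. Conversely, whenever
-- m² < n < 2m² the sequence n < 2m² < 2n has product (2mn)², and such an m exists for every
-- n ≥ 10 (take m = ⌊√(n − 1)⌋) and for n = 5, 6, 7.
module Submission where

open import Defs
open import Data.Nat using (ℕ; _*_; _<_)
open import Data.Nat.Primality using (Prime)

open import Data.Nat using (zero; suc; _+_; _≤_; z≤n; s≤s; _≤?_; _<?_)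
open import Data.Nat.Properties
open import Data.Nat.Divisibility
  using (_∣_; divides; *-pres-∣; *-cancelˡ-∣; ∣1⇒≡1; quotient>1; m∣n⇒n≡quotient*m)
open import Data.Nat.Primality using (euclidsLemma; prime⇒nonZero; ¬prime[1]; prime⇒¬composite; composite)
open import Data.Nat.ListAction using (product)
open import Data.Nat.Solver using (module +-*-Solver)
open import Data.List using ([]; _∷_; last)
open import Data.List.Relation.Unary.All as All using (All; []; _∷_)
open import Data.List.Relation.Unary.Any using (Any; here; there)
import Data.List.Relation.Unary.AllPairs as AllPairs
open import Data.List.Relation.Unary.Linked using (Linked; []; [-]; _∷_)
open import Data.List.Relation.Unary.Linked.Properties using (Linked⇒AllPairs)
open import Data.Maybe using (just)
open import Data.Product using (∃-syntax; _×_; _,_)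
open import Data.Sum using (inj₁; inj₂)
open import Data.Empty using (⊥-elim)
open import Relation.Nullary using (yes; no)
open import Relation.Binary.PropositionalEquality using (_≡_; refl; sym; subst; subst₂)

open +-*-Solver

prime∣product⇒Any∣ : ∀ {p} xs → Prime p → p ∣ product xs → Any (p ∣_) xs
prime∣product⇒Any∣ [] pp p∣1 = ⊥-elim (¬prime[1] (subst Prime (∣1⇒≡1 p∣1) pp))
prime∣product⇒Any∣ (x ∷ xs) pp p∣x*Πxs with euclidsLemma x (product xs) pp p∣x*Πxs
... | inj₁ p∣x  = here p∣x
... | inj₂ p∣Πxs = there (prime∣product⇒Any∣ xs pp p∣Πxs)

p*m≡square⇒p∣m : ∀ {p m} r → Prime p → p * m ≡ r * r → p ∣ m
p*m≡square⇒p∣m {p} {m} r pp pm≡r² = *-cancelˡ-∣ p ⦃ prime⇒nonZero pp ⦄ p*p∣p*m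
  where
  p∣r : p ∣ r
  p∣r with euclidsLemma r r pp (subst (p ∣_) pm≡r² (divides m (*-comm p m)))
  ... | inj₁ p∣r = p∣r
  ... | inj₂ p∣r = p∣r

  p*p∣p*m : p * p ∣ p * m
  p*p∣p*m = subst (p * p ∣_) (sym pm≡r²) (*-pres-∣ p∣r p∣r)

multiple>⇒2*≤ : ∀ {p y} → p ∣ y → p < y → 2 * p ≤ y
multiple>⇒2*≤ {p} {y} p∣y p<y =
  subst (2 * p ≤_) (sym (m∣n⇒n≡quotient*m p∣y)) (*-monoˡ-≤ p (quotient>1 p∣y p<y))

Linked⇒All≤last : ∀ {xs k} → Linked _<_ xs → last xs ≡ just k → All (_≤ k) xs
Linked⇒All≤last [-] refl = ≤-refl ∷ []
Linked⇒All≤last (x<y ∷ l) last≡k with Linked⇒All≤last l last≡k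
... | y≤k ∷ ys≤k = ≤-trans (<⇒≤ x<y) y≤k ∷ y≤k ∷ ys≤k

Reachable-prime⇒2*≤ : ∀ {p k} → Prime p → Reachable p k → 2 * p ≤ k
Reachable-prime⇒2*≤ {p} {k} pp (_ , rest , refl , sorted , last≡k , r , square) =
  All.lookupWith (λ { (p<y , y≤k) p∣y → ≤-trans (multiple>⇒2*≤ p∣y p<y) y≤k })
    (All.zip (rest>p , rest≤k)) (prime∣product⇒Any∣ rest pp (p*m≡square⇒p∣m r pp square))
  where
  rest>p : All (p <_) rest
  rest>p = AllPairs.head (Linked⇒AllPairs <-trans sorted)

  rest≤k : All (_≤ k) rest
  rest≤k = All.tail (Linked⇒All≤last sorted last≡k)

Reachable-double : ∀ {n} m → m * m < n → n < 2 * (m * m) → Reachable n (2 * n)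
Reachable-double {n} m m²<n n<2m² =
  (n ∷ 2 * (m * m) ∷ 2 * n ∷ []) , _ , refl ,
  (n<2m² ∷ *-monoʳ-< 2 m²<n ∷ [-]) , refl ,
  2 * m * n , solve 2 (λ n m → n :* ((con 2 :* (m :* m)) :* ((con 2 :* n) :* con 1))
                             := (con 2 :* m :* n) :* (con 2 :* m :* n)) refl n m

∃-floor-sqrt : ∀ n → ∃[ m ] m * m ≤ n × n < suc m * suc m
∃-floor-sqrt zero = 0 , z≤n , s≤s z≤n
∃-floor-sqrt (suc n) with ∃-floor-sqrt n
... | m , m²≤n , n<[m+1]² with suc n <? suc m * suc m
...   | yes n+1<[m+1]² = m , m≤n⇒m≤1+n m²≤n , n+1<[m+1]²
...   | no  n+1≮[m+1]² = suc m , ≤-reflexive [m+1]²≡n+1 , n+1<[m+2]²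
  where
  [m+1]²≡n+1 : suc m * suc m ≡ suc n
  [m+1]²≡n+1 = ≤-antisym (≮⇒≥ n+1≮[m+1]²) n<[m+1]²

  [m+2]²≡[m+1]²+2m+3 : suc (suc m) * suc (suc m) ≡ suc m * suc m + (3 + 2 * m)
  [m+2]²≡[m+1]²+2m+3 = solve 1 (λ m → (con 2 :+ m) :* (con 2 :+ m)
                                     := (con 1 :+ m) :* (con 1 :+ m) :+ (con 3 :+ con 2 :* m)) refl m

  n+1<[m+2]² : suc n < suc (suc m) * suc (suc m)
  n+1<[m+2]² = subst₂ _<_ [m+1]²≡n+1 (sym [m+2]²≡[m+1]²+2m+3) (m<m+n (suc m * suc m) (s≤s z≤n))

[m+1]²<2m² : ∀ {m} → 3 ≤ m → suc m * suc m < 2 * (m * m)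
[m+1]²<2m² {m@(suc (suc (suc t)))} (s≤s (s≤s (s≤s _))) =
  subst (suc m * suc m <_) (sym 2m²≡[m+1]²+2+4t+t²) (m<m+n (suc m * suc m) (s≤s z≤n))
  where
  2m²≡[m+1]²+2+4t+t² : 2 * (m * m) ≡ suc m * suc m + (2 + 4 * t + t * t)
  2m²≡[m+1]²+2+4t+t² = solve 1 (λ t → con 2 :* ((con 3 :+ t) :* (con 3 :+ t))
                                    := (con 4 :+ t) :* (con 4 :+ t) :+ (con 2 :+ con 4 :* t :+ t :* t)) refl t

square<n<2*square : ∀ n → 10 ≤ n → ∃[ m ] m * m < n × n < 2 * (m * m)
square<n<2*square (suc n) (s≤s 9≤n) with ∃-floor-sqrt n
... | m , m²≤n , n<[m+1]² with 3 ≤? m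
...   | yes 3≤m = m , s≤s m²≤n , ≤-<-trans n<[m+1]² ([m+1]²<2m² 3≤m)
...   | no  3≰m = ⊥-elim (<⇒≱ (<-≤-trans n<[m+1]² [m+1]²≤9) 9≤n)
  where
  [m+1]²≤9 : suc m * suc m ≤ 9
  [m+1]²≤9 = *-mono-≤ (≰⇒> 3≰m) (≰⇒> 3≰m)

Reachable-prime⇒double : ∀ {p} → Prime p → 3 < p → Reachable p (2 * p)
Reachable-prime⇒double {2} _ (s≤s (s≤s ()))
Reachable-prime⇒double {3} _ (s≤s (s≤s (s≤s ())))
Reachable-prime⇒double {4} 4-prime _ = ⊥-elim (prime⇒¬composite 4-prime (composite {2} (s≤s (s≤s (s≤s z≤n))) (divides 2 refl)))
Reachable-prime⇒double {5} _ _ = Reachable-double 2 (s≤s (s≤s (s≤s (s≤s (s≤s z≤n))))) (+-monoʳ-≤ 6 z≤n)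
Reachable-prime⇒double {6} _ _ = Reachable-double 2 (s≤s (s≤s (s≤s (s≤s (s≤s z≤n))))) (+-monoʳ-≤ 7 z≤n)
Reachable-prime⇒double {7} _ _ = Reachable-double 2 (s≤s (s≤s (s≤s (s≤s (s≤s z≤n))))) (+-monoʳ-≤ 8 z≤n)
Reachable-prime⇒double {8} 8-prime _ = ⊥-elim (prime⇒¬composite 8-prime (composite {2} (s≤s (s≤s (s≤s z≤n))) (divides 4 refl)))
Reachable-prime⇒double {9} 9-prime _ = ⊥-elim (prime⇒¬composite 9-prime (composite {3} (s≤s (s≤s (s≤s (s≤s z≤n)))) (divides 3 refl)))
Reachable-prime⇒double {p@(suc (suc (suc (suc (suc (suc (suc (suc (suc (suc _))))))))))} _ _ =
  let m , m²<p , p<2m² = square<n<2*square p (+-monoʳ-≤ 10 z≤n) in Reachable-double m m²<p p<2m²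

lemma1p7 : (p : ℕ) → Prime p → 3 < p → IsG p (2 * p)
lemma1p7 p p-prime 3<p = Reachable-prime⇒double p-prime 3<p , λ _ → Reachable-prime⇒2*≤ p-prime
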